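{- Let $G$ be a simple finite graph with no isolated vertices, and let $b(G)$ be the number of edges in a maximal bipartite subgraph of $G$. Then the dispensing number satisfies $\vartheta(G)=|E(G)|-b(G)$.
   Context: An integer additive set-indexer (IASI) of $G$ is an injective map $f:V(G)\to\mathcal{P}(\mathbb{N}_0)$ (finite subsets of non-negative integers) such that $f^+(uv)=f(u)+f(v)=\{a+b:a\in f(u),b\in f(v)\}$ is injective on $E(G)$. An AP-set is a set of at least three non-negative integers in arithmetic progression; its common difference is its deterministic index. An arithmetic IASI (AIASI) is an IASI for which all vertex set-labels $f(v)$ and all edge set-labels $f^+(e)$ are AP-sets. For an edge $uv$, if the deterministic index of one end is a positive integer multiple of that of the other end, this integer ratio (larger index over smaller) is the deterministic ratio of the edge. The dispensing number $\vartheta(G)$ is the minimum possible number of edges of $G$ that do not have a prime deterministic ratio (minimum over arithmetic IASIs of $G$). -}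

module Defs where

open import Data.Nat using (ℕ; _+_; _*_; _≤_; _<_; _∸_)
open import Data.Nat.Primality using (Prime)
open import Data.Fin using (Fin)
open import Data.Fin.Subset using (Subset; _∈_; ∣_∣)
open import Data.Bool using (Bool)
open import Data.List using (List; concatMap; map)
open import Data.List.Membership.Propositional renaming (_∈_ to _∈ˡ_)
open import Data.Product using (Σ; ∃; _×_; _,_; proj₁; proj₂)
open import Data.Sum using (_⊎_)
open import Relation.Nullary using (¬_)
open import Relation.Binary.PropositionalEquality using (_≡_; _≢_)

record Graph : Set where
  field
    n      : ℕ
    m      : ℕ
    ends   : Fin m → Fin n × Fin n
    noLoop : ∀ e → proj₁ (ends e) ≢ proj₂ (ends e)
    noMulti : ∀ e e' →
      ((proj₁ (ends e) ≡ proj₁ (ends e') × proj₂ (ends e) ≡ proj₂ (ends e'))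
       ⊎ (proj₁ (ends e) ≡ proj₂ (ends e') × proj₂ (ends e) ≡ proj₁ (ends e'))) →
      e ≡ e'

open Graph public

IsEnd : (G : Graph) → Fin (n G) → Fin (m G) → Set
IsEnd G v e = (proj₁ (ends G e) ≡ v) ⊎ (proj₂ (ends G e) ≡ v)

NoIsolatedVertices : Graph → Set
NoIsolatedVertices G = ∀ v → ∃ λ e → IsEnd G v e

-- Finite subsets of ℕ₀, represented by lists (order / repetition
-- irrelevant; equality of sets is extensional equality of membership).

FinSet : Set
FinSet = List ℕ

_≈ˢ_ : FinSet → FinSet → Set
A ≈ˢ B = ∀ x → (x ∈ˡ A → x ∈ˡ B) × (x ∈ˡ B → x ∈ˡ A)

_⊕_ : FinSet → FinSet → FinSet
A ⊕ B = concatMap (λ a → map (a +_) B) A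

HasDetIndex : FinSet → ℕ → Set
HasDetIndex S d = Σ ℕ λ a → Σ ℕ λ k →
  (1 ≤ d) × (3 ≤ k) ×
  (∀ x → (x ∈ˡ S → Σ ℕ λ i → i < k × x ≡ a + i * d)
       × (Σ ℕ (λ i → i < k × x ≡ a + i * d) → x ∈ˡ S))

IsAPSet : FinSet → Set
IsAPSet S = ∃ λ d → HasDetIndex S d

Labelling : Graph → Set
Labelling G = Fin (n G) → FinSet

edgeLabel : (G : Graph) → Labelling G → Fin (m G) → FinSet
edgeLabel G f e = f (proj₁ (ends G e)) ⊕ f (proj₂ (ends G e))

IsIASI : (G : Graph) → Labelling G → Set
IsIASI G f =
  (∀ u v → f u ≈ˢ f v → u ≡ v) ×
  (∀ e e' → edgeLabel G f e ≈ˢ edgeLabel G f e' → e ≡ e')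

IsAIASI : (G : Graph) → Labelling G → Set
IsAIASI G f = IsIASI G f × (∀ v → IsAPSet (f v)) × (∀ e → IsAPSet (edgeLabel G f e))

HasPrimeRatio : (G : Graph) → Labelling G → Fin (m G) → Set
HasPrimeRatio G f e = Σ ℕ λ du → Σ ℕ λ dv → Σ ℕ λ p →
  HasDetIndex (f (proj₁ (ends G e))) du × HasDetIndex (f (proj₂ (ends G e))) dv ×
  Prime p × ((dv ≡ p * du) ⊎ (du ≡ p * dv))

NonPrimeEdgeCount : (G : Graph) → Labelling G → ℕ → Set
NonPrimeEdgeCount G f c = Σ (Subset (m G)) λ s →
  (∣ s ∣ ≡ c) × (∀ e → (e ∈ s → ¬ HasPrimeRatio G f e) × (¬ HasPrimeRatio G f e → e ∈ s))

IsDispensingNumber : Graph → ℕ → Set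
IsDispensingNumber G N =
  (Σ (Labelling G) λ f → IsAIASI G f × NonPrimeEdgeCount G f N) ×
  (∀ f → IsAIASI G f → ∀ c → NonPrimeEdgeCount G f c → N ≤ c)

IsBipartiteEdgeSet : (G : Graph) → Subset (m G) → Set
IsBipartiteEdgeSet G s = Σ (Fin (n G) → Bool) λ col →
  ∀ e → e ∈ s → col (proj₁ (ends G e)) ≢ col (proj₂ (ends G e))

IsMaxBipartiteSize : Graph → ℕ → Set
IsMaxBipartiteSize G b =
  (Σ (Subset (m G)) λ s → IsBipartiteEdgeSet G s × ∣ s ∣ ≡ b) ×
  (∀ s → IsBipartiteEdgeSet G s → ∣ s ∣ ≤ b)

module Submission where

-- Lower bound.  Fix an arithmetic IASI f and colour each vertex by the
-- parity of Ω(d), the number of prime factors (with multiplicity) of its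
-- deterministic index d.  Since Ω(p·d) = Ω(d) + 1 for p prime, every edge
-- with a prime deterministic ratio joins vertices of different colours, so
-- these edges form a bipartite subgraph: there are at most b(G) of them.
--
-- Upper bound.  Take a 2-colouring realising b(G) and give vertex x the
-- progression {2^x, 2^x + δ, 2^x + 2δ}, with δ = 1 or 2 according to its
-- colour.  Sums of two such progressions are again progressions (general
-- lemma on sumsets of APs), their first terms 2^x + 2^y determine the edge
-- (the powers of two form a Sidon set), and an edge has a prime ratio
-- (namely 2) exactly when its ends have different colours.

open import Defs
open import Data.Nat using (ℕ; zero; suc; _+_; _*_; _∸_; _^_; _≤_; _<_; z≤n; s≤s; z<s; s<s; NonZero)
open import Data.Nat.Base using (nonTrivial⇒n>1)
open import Data.Nat.Properties
open import Data.Nat.Logarithm using (⌊log₂_⌋; ⌊log₂[2^n]⌋≡n)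
open import Data.Nat.Primality using (Prime; prime[2]; prime⇒nonZero; prime⇒nonTrivial)
open import Data.Nat.Primality.Factorisation using (PrimeFactorisation; factorise; factorisationUnique)
open import Data.Nat.Solver using (module +-*-Solver)
open import Data.Bool using (Bool; true; false; not; _xor_)
open import Data.Bool.Properties using (not-¬)
open import Data.Fin using (Fin; toℕ)
open import Data.Fin.Properties using (toℕ-injective)
open import Data.Fin.Subset using (Subset; ∁; ∣_∣) renaming (_∈_ to _∈ₛ_)
open import Data.Fin.Subset.Properties using (x∈∁p⇒x∉p; x∉p⇒x∈∁p; ∣∁p∣≡n∸∣p∣; p⊆q⇒∣p∣≤∣q∣)
open import Data.List using (_∷_; applyUpTo; length; map)
open import Data.List.Membership.Propositional using (find; lose) renaming (_∈_ to _∈ˡ_)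
open import Data.List.Membership.Propositional.Properties
  using (∈-concatMap⁻; ∈-concatMap⁺; ∈-map⁻; ∈-map⁺; ∈-applyUpTo⁻; ∈-applyUpTo⁺)
open import Data.List.Relation.Unary.All using (_∷_)
open import Data.List.Relation.Binary.Permutation.Propositional.Properties using (↭-length)
open import Data.Vec using (tabulate)
open import Data.Vec.Properties using (lookup∘tabulate; []=⇒lookup; lookup⇒[]=)
open import Data.Product using (Σ; _×_; _,_; proj₁; proj₂)
import Data.Product as Product
open import Data.Sum using (_⊎_; inj₁; inj₂)
import Data.Sum as Sum
open import Data.Empty using (⊥-elim)
open import Function using (_∘_)
open import Relation.Nullary using (yes; no)
open import Relation.Binary.PropositionalEquality

open PrimeFactorisation

∈-⊕⁻ : ∀ {A B x} → x ∈ˡ A ⊕ B → Σ ℕ λ y → Σ ℕ λ z → y ∈ˡ A × z ∈ˡ B × x ≡ y + z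
∈-⊕⁻ {A} {B} x∈A⊕B with find (∈-concatMap⁻ (λ a → map (a +_) B) {xs = A} x∈A⊕B)
... | y , y∈A , x∈y+B with ∈-map⁻ (y +_) x∈y+B
... | z , z∈B , x≡y+z = y , z , y∈A , z∈B , x≡y+z

∈-⊕⁺ : ∀ {A B y z} → y ∈ˡ A → z ∈ˡ B → y + z ∈ˡ A ⊕ B
∈-⊕⁺ {A} {B} {y} y∈A z∈B =
  ∈-concatMap⁺ (λ a → map (a +_) B) {xs = A} (lose y∈A (∈-map⁺ (y +_) z∈B))

∈-⊕-comm : ∀ {A B x} → x ∈ˡ A ⊕ B → x ∈ˡ B ⊕ A
∈-⊕-comm {A} {B} x∈A⊕B with ∈-⊕⁻ {A} {B} x∈A⊕B
... | y , z , y∈A , z∈B , refl = subst (_∈ˡ B ⊕ A) (+-comm z y) (∈-⊕⁺ {B} {A} z∈B y∈A)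

Enumerates : FinSet → ℕ → ℕ → ℕ → Set
Enumerates S a d k = ∀ x →
  (x ∈ˡ S → Σ ℕ λ i → i < k × x ≡ a + i * d) × (Σ ℕ (λ i → i < k × x ≡ a + i * d) → x ∈ˡ S)

APStartingAt : FinSet → ℕ → Set
APStartingAt S a = Σ ℕ λ d → Σ ℕ λ k → 1 ≤ d × 3 ≤ k × Enumerates S a d k

startingAt⇒AP : ∀ {S a} → APStartingAt S a → IsAPSet S
startingAt⇒AP {a = a} (d , k , 1≤d , 3≤k , enum) = d , a , k , 1≤d , 3≤k , enum

ap : ℕ → ℕ → ℕ → FinSet
ap a d k = applyUpTo (λ i → a + i * d) k

ap-enumerates : ∀ a d k → Enumerates (ap a d k) a d k
ap-enumerates a d k x =
  ∈-applyUpTo⁻ (λ i → a + i * d) , λ { (i , i<k , refl) → ∈-applyUpTo⁺ (λ i → a + i * d) i<k }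

ap-detIndex : ∀ a d → 1 ≤ d → HasDetIndex (ap a d 3) d
ap-detIndex a d 1≤d = a , 3 , 1≤d , ≤-refl , ap-enumerates a d 3

-- Elementary facts about an AP-set a, a + d, a + 2d, …: its first two
-- terms are its two least elements.  They make the first term and the
-- deterministic index invariants of the set.
module _ {S d} (h : HasDetIndex S d) where

  index-positive : 1 ≤ d
  index-positive = proj₁ (proj₂ (proj₂ h))

  private
    a k : ℕ
    a = proj₁ h
    k = proj₁ (proj₂ h)
    3≤k : 3 ≤ k
    3≤k = proj₁ (proj₂ (proj₂ (proj₂ h)))
    enum : Enumerates S a d k
    enum = proj₂ (proj₂ (proj₂ (proj₂ h)))

  start-∈ : a ∈ˡ S
  start-∈ = proj₂ (enum a) (0 , ≤-trans (s≤s z≤n) 3≤k , sym (+-identityʳ a))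

  second-∈ : a + d ∈ˡ S
  second-∈ = proj₂ (enum (a + d)) (1 , ≤-trans (s≤s (s≤s z≤n)) 3≤k , cong (a +_) (sym (+-identityʳ d)))

  start-least : ∀ {x} → x ∈ˡ S → a ≤ x
  start-least x∈S with proj₁ (enum _) x∈S
  ... | i , _ , refl = m≤m+n a (i * d)

  second-least : ∀ {x} → x ∈ˡ S → a < x → a + d ≤ x
  second-least x∈S a<x with proj₁ (enum _) x∈S
  ... | zero  , _ , refl = ⊥-elim (<-irrefl (sym (+-identityʳ a)) a<x)
  ... | suc i , _ , refl = +-monoʳ-≤ a (m≤m+n d (i * d))

≈ˢ-refl : ∀ {S} → S ≈ˢ S
≈ˢ-refl x = (λ x∈S → x∈S) , (λ x∈S → x∈S)

start-unique : ∀ {S T d d'} → S ≈ˢ T → (h : HasDetIndex S d) (h' : HasDetIndex T d') → proj₁ h ≡ proj₁ h'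
start-unique S≈T h h' =
  ≤-antisym (start-least h (proj₂ (S≈T _) (start-∈ h'))) (start-least h' (proj₁ (S≈T _) (start-∈ h)))

detIndex-unique : ∀ {S d d'} → HasDetIndex S d → HasDetIndex S d' → d ≡ d'
detIndex-unique {d = d} {d'} h h' =
  +-cancelˡ-≡ (proj₁ h) d d' (trans (≤-antisym (second-before h h') (second-before h' h)) same-start)
  where
  same-start : proj₁ h' + d' ≡ proj₁ h + d'
  same-start = cong (_+ d') (start-unique ≈ˢ-refl h' h)
  second-before : ∀ {e e'} (g : HasDetIndex _ e) (g' : HasDetIndex _ e') → proj₁ g + e ≤ proj₁ g' + e'
  second-before g g' = second-least g (second-∈ g')
    (subst (_< proj₁ g' + _) (start-unique ≈ˢ-refl g' g) (m<m+n _ (index-positive g')))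

-- Every t < l·q + k is i + j·q with i < k and j ≤ l, provided q ≤ k
-- (the blocks [j·q, j·q + k) cover [0, l·q + k) without gaps).
offset-decompose : ∀ {q k} → q ≤ k → ∀ l t → t < l * q + k →
  Σ ℕ λ i → Σ ℕ λ j → i < k × j < suc l × t ≡ i + j * q
offset-decompose q≤k zero t t<k = t , 0 , t<k , z<s , sym (+-identityʳ t)
offset-decompose {q} {k} q≤k (suc l) t t<bound with t <? k
... | yes t<k = t , 0 , t<k , z<s , sym (+-identityʳ t)
... | no t≮k with offset-decompose q≤k l (t ∸ q) rest<
  where
  q+rest≡t : q + (t ∸ q) ≡ t
  q+rest≡t = m+[n∸m]≡n (≤-trans q≤k (≮⇒≥ t≮k))
  rest< : t ∸ q < l * q + k
  rest< = +-cancelˡ-< q _ _ (subst (_< q + (l * q + k)) (sym q+rest≡t)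
            (subst (t <_) (+-assoc q (l * q) k) t<bound))
... | i , j , i<k , j<1+l , rest≡ = i , suc j , i<k , s<s j<1+l , (begin
  t                   ≡⟨ sym (m+[n∸m]≡n (≤-trans q≤k (≮⇒≥ t≮k))) ⟩
  q + (t ∸ q)         ≡⟨ cong (q +_) rest≡ ⟩
  q + (i + j * q)     ≡⟨ +-*-Solver.solve 3 (λ q i j → q :+ (i :+ j :* q) := i :+ (q :+ j :* q)) refl q i j ⟩
  i + (q + j * q)     ∎)
  where open ≡-Reasoning
        open +-*-Solver

offset-bound : ∀ {q k l i j} → i < k → j < suc l → i + j * q < l * q + k
offset-bound {q} {k} {l} {i} {j} i<k (s≤s j≤l) =
  subst (i + j * q <_) (+-comm k (l * q)) (+-mono-<-≤ i<k (*-monoˡ-≤ q j≤l))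

offset-sum : ∀ a b d q i j → (a + i * d) + (b + j * (q * d)) ≡ (a + b) + (i + j * q) * d
offset-sum = +-*-Solver.solve 6
  (λ a b d q i j → (a :+ i :* d) :+ (b :+ j :* (q :* d)) := (a :+ b) :+ (i :+ j :* q) :* d) refl
  where open +-*-Solver

⊕-enumerates : ∀ {S T a b d q k l} → Enumerates S a d k → Enumerates T b (q * d) (suc l) → q ≤ k →
  Enumerates (S ⊕ T) (a + b) d (l * q + k)
⊕-enumerates {S} {T} {a} {b} {d} {q} {k} {l} enumS enumT q≤k x = into , onto
  where
  into : x ∈ˡ S ⊕ T → Σ ℕ λ t → t < l * q + k × x ≡ a + b + t * d
  into x∈ with ∈-⊕⁻ {S} {T} x∈
  ... | y , z , y∈S , z∈T , refl with proj₁ (enumS y) y∈S | proj₁ (enumT z) z∈T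
  ... | i , i<k , refl | j , j<1+l , refl = i + j * q , offset-bound i<k j<1+l , offset-sum a b d q i j
  onto : (Σ ℕ λ t → t < l * q + k × x ≡ a + b + t * d) → x ∈ˡ S ⊕ T
  onto (t , t< , refl) with offset-decompose q≤k l t t<
  ... | i , j , i<k , j<1+l , refl = subst (_∈ˡ S ⊕ T) (offset-sum a b d q i j)
    (∈-⊕⁺ {S} {T} (proj₂ (enumS _) (i , i<k , refl)) (proj₂ (enumT _) (j , j<1+l , refl)))

⊕-enumerates-comm : ∀ {S T a d k} → Enumerates (T ⊕ S) a d k → Enumerates (S ⊕ T) a d k
⊕-enumerates-comm {S} {T} enum x =
  (λ x∈ → proj₁ (enum x) (∈-⊕-comm {S} {T} x∈)) , (λ w → ∈-⊕-comm {T} {S} (proj₂ (enum x) w))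

Ω : ℕ → ℕ
Ω zero    = 0
Ω (suc n) = length (factors (factorise (suc n)))

Ω-factorisation : ∀ n → NonZero n → (F : PrimeFactorisation n) → Ω n ≡ length (factors F)
Ω-factorisation (suc n) _ F = ↭-length (factorisationUnique (factorise (suc n)) F)

Ω-prime-* : ∀ {p} d → Prime p → 1 ≤ d → Ω (p * d) ≡ suc (Ω d)
Ω-prime-* {p} d@(suc _) p-prime _ = Ω-factorisation (p * d) (m*n≢0 p d) p·factors
  where
  instance _ = prime⇒nonZero p-prime
  p·factors : PrimeFactorisation (p * d)
  p·factors = record
    { factors         = p ∷ factors (factorise d)
    ; isFactorisation = cong (p *_) (isFactorisation (factorise d))
    ; factorsPrime    = p-prime ∷ factorsPrime (factorise d) }

isEven : ℕ → Bool
isEven zero    = true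
isEven (suc n) = not (isEven n)

Ω-parity-flips : ∀ {p} d → Prime p → 1 ≤ d → isEven (Ω (p * d)) ≢ isEven (Ω d)
Ω-parity-flips d p-prime 1≤d same =
  not-¬ refl (sym (trans (cong isEven (sym (Ω-prime-* d p-prime 1≤d))) same))

≢-prime-multiple : ∀ {p d} → Prime p → 1 ≤ d → d ≢ p * d
≢-prime-multiple {p} {d@(suc _)} p-prime _ =
  <⇒≢ (subst (d <_) (*-comm d p) (m<m*n d p (nonTrivial⇒n>1 p)))
  where instance _ = prime⇒nonTrivial p-prime

2^-injective : ∀ {i j} → 2 ^ i ≡ 2 ^ j → i ≡ j
2^-injective {i} {j} eq = trans (sym (⌊log₂[2^n]⌋≡n i)) (trans (cong ⌊log₂_⌋ eq) (⌊log₂[2^n]⌋≡n j))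

halve : ∀ {m n} → 2 * m ≡ 2 * n → m ≡ n
halve {m} {n} = *-cancelˡ-≡ m n 2

-- 2^(i+1) + 2^(j+1) = 2·(2^i + 2^j) is even, whereas 2^0 + 2^(j+1) is odd.
double-sum : ∀ i j → 2 ^ suc i + 2 ^ suc j ≡ 2 * (2 ^ i + 2 ^ j)
double-sum i j = sym (*-distribˡ-+ 2 (2 ^ i) (2 ^ j))

odd≢double-sum : ∀ j k l → 2 ^ 0 + 2 ^ suc j ≢ 2 ^ suc k + 2 ^ suc l
odd≢double-sum j k l eq = even≢odd (2 ^ k + 2 ^ l) (2 ^ j) (sym (trans eq (double-sum k l)))

sidon-from-0 : ∀ j k l → k ≢ l → 2 ^ 0 + 2 ^ suc j ≡ 2 ^ k + 2 ^ l →
  (0 ≡ k × suc j ≡ l) ⊎ (0 ≡ l × suc j ≡ k)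
sidon-from-0 j zero    zero    k≢l _  = ⊥-elim (k≢l refl)
sidon-from-0 j zero    (suc l) _   eq = inj₁ (refl , cong suc (2^-injective (halve (suc-injective eq))))
sidon-from-0 j (suc k) zero    _   eq =
  inj₂ (refl , cong suc (2^-injective (halve (suc-injective (trans eq (+-comm (2 ^ suc k) 1))))))
sidon-from-0 j (suc k) (suc l) _   eq = ⊥-elim (odd≢double-sum j k l eq)

sidon : ∀ i j k l → i ≢ j → k ≢ l → 2 ^ i + 2 ^ j ≡ 2 ^ k + 2 ^ l →
  (i ≡ k × j ≡ l) ⊎ (i ≡ l × j ≡ k)
sidon zero    zero    _       _       i≢j _   _  = ⊥-elim (i≢j refl)
sidon zero    (suc j) k       l       _   k≢l eq = sidon-from-0 j k l k≢l eq
sidon (suc i) zero    k       l       _   k≢l eq =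
  Sum.swap (Sum.map Product.swap Product.swap (sidon-from-0 i k l k≢l (trans (+-comm 1 (2 ^ suc i)) eq)))
sidon (suc i) (suc j) zero    zero    _   k≢l _  = ⊥-elim (k≢l refl)
sidon (suc i) (suc j) zero    (suc l) _   _   eq = ⊥-elim (odd≢double-sum l i j (sym eq))
sidon (suc i) (suc j) (suc k) zero    _   _   eq =
  ⊥-elim (odd≢double-sum k i j (trans (+-comm 1 (2 ^ suc k)) (sym eq)))
sidon (suc i) (suc j) (suc k) (suc l) i≢j k≢l eq =
  Sum.map (Product.map (cong suc) (cong suc)) (Product.map (cong suc) (cong suc))
    (sidon i j k l (i≢j ∘ cong suc) (k≢l ∘ cong suc)
      (halve (trans (sym (double-sum i j)) (trans eq (double-sum k l)))))

-- Lower bound: for any arithmetic IASI the edges with a prime ratio form a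
-- bipartite subgraph, coloured by the parity of Ω of the vertex indices.
module _ (G : Graph) where

  private
    src tgt : Fin (m G) → Fin (n G)
    src e = proj₁ (ends G e)
    tgt e = proj₂ (ends G e)

  Ω-colouring : (f : Labelling G) → (∀ v → IsAPSet (f v)) → Fin (n G) → Bool
  Ω-colouring f apV v = isEven (Ω (proj₁ (apV v)))

  -- The index of one end is p times that of the other, so Ω differs by one.
  prime-ratio⇒Ω-bichromatic : ∀ f (apV : ∀ v → IsAPSet (f v)) e → HasPrimeRatio G f e →
    Ω-colouring f apV (src e) ≢ Ω-colouring f apV (tgt e)
  prime-ratio⇒Ω-bichromatic f apV e (du , dv , p , hu , hv , p-prime , ratio)
    with detIndex-unique hu (proj₂ (apV (src e))) | detIndex-unique hv (proj₂ (apV (tgt e)))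
  ... | refl | refl with ratio
  ... | inj₁ dv≡p*du = λ same →
    Ω-parity-flips du p-prime (index-positive hu) (trans (cong (isEven ∘ Ω) (sym dv≡p*du)) (sym same))
  ... | inj₂ du≡p*dv = λ same →
    Ω-parity-flips dv p-prime (index-positive hv) (trans (cong (isEven ∘ Ω) (sym du≡p*dv)) same)

  dispensing-lower-bound : ∀ b → IsMaxBipartiteSize G b →
    ∀ f → IsAIASI G f → ∀ c → NonPrimeEdgeCount G f c → m G ∸ b ≤ c
  dispensing-lower-bound b (_ , maximal) f (_ , apV , _) c (s , ∣s∣≡c , s-spec) =
    m≤n+o⇒m∸n≤o (m G) b (begin
      m G             ≤⟨ m≤n+m∸n (m G) c ⟩
      c + (m G ∸ c)   ≤⟨ +-monoʳ-≤ c prime-edges≤b ⟩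
      c + b           ≡⟨ +-comm c b ⟩
      b + c           ∎)
    where
    open ≤-Reasoning
    prime-edges-bipartite : IsBipartiteEdgeSet G (∁ s)
    prime-edges-bipartite = Ω-colouring f apV , λ e e∈∁s same →
      x∈∁p⇒x∉p e∈∁s (proj₂ (s-spec e) (λ prime → prime-ratio⇒Ω-bichromatic f apV e prime same))
    prime-edges≤b : m G ∸ c ≤ b
    prime-edges≤b = subst (_≤ b) (trans (∣∁p∣≡n∸∣p∣ s) (cong (m G ∸_) ∣s∣≡c))
                      (maximal (∁ s) prime-edges-bipartite)

δ : Bool → ℕ
δ false = 1
δ true  = 2

1≤δ : ∀ c → 1 ≤ δ c
1≤δ false = s≤s z≤n
1≤δ true  = s≤s z≤n

-- The sum of 3-term progressions with differences in {1, 2} is an AP-set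
-- (⊕-enumerates with q = 1 for equal differences, q = 2 otherwise).
δ-sum-AP : ∀ a b c c' → APStartingAt (ap a (δ c) 3 ⊕ ap b (δ c') 3) (a + b)
δ-sum-AP a b false false = 1 , 5 , s≤s z≤n , s≤s (s≤s (s≤s z≤n)) ,
  ⊕-enumerates {l = 2} (ap-enumerates a 1 3) (ap-enumerates b 1 3) (s≤s z≤n)
δ-sum-AP a b true  true  = 2 , 5 , s≤s z≤n , s≤s (s≤s (s≤s z≤n)) ,
  ⊕-enumerates {l = 2} (ap-enumerates a 2 3) (ap-enumerates b 2 3) (s≤s z≤n)
δ-sum-AP a b false true  = 1 , 7 , s≤s z≤n , s≤s (s≤s (s≤s z≤n)) ,
  ⊕-enumerates {l = 2} (ap-enumerates a 1 3) (ap-enumerates b 2 3) (s≤s (s≤s z≤n))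
δ-sum-AP a b true  false with δ-sum-AP b a false true
... | d , k , 1≤d , 3≤k , enum =
  d , k , 1≤d , 3≤k , subst (λ s → Enumerates (ap a 2 3 ⊕ ap b 1 3) s d k) (+-comm b a)
                          (⊕-enumerates-comm {ap a 2 3} {ap b 1 3} enum)

module ColourLabelling (G : Graph) (col : Fin (n G) → Bool) where

  private
    src tgt : Fin (m G) → Fin (n G)
    src e = proj₁ (ends G e)
    tgt e = proj₂ (ends G e)

  label : Labelling G
  label x = ap (2 ^ toℕ x) (δ (col x)) 3

  vertex-detIndex : ∀ x → HasDetIndex (label x) (δ (col x))
  vertex-detIndex x = ap-detIndex (2 ^ toℕ x) (δ (col x)) (1≤δ (col x))

  edge-AP : ∀ e → APStartingAt (edgeLabel G label e) (2 ^ toℕ (src e) + 2 ^ toℕ (tgt e))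
  edge-AP e = δ-sum-AP (2 ^ toℕ (src e)) (2 ^ toℕ (tgt e)) (col (src e)) (col (tgt e))

  -- Labels are recovered from first terms: 2^x for vertices, 2^x + 2^y for edges.
  label-injective : ∀ x y → label x ≈ˢ label y → x ≡ y
  label-injective x y eq =
    toℕ-injective (2^-injective (start-unique eq (vertex-detIndex x) (vertex-detIndex y)))

  edgeLabel-injective : ∀ e e' → edgeLabel G label e ≈ˢ edgeLabel G label e' → e ≡ e'
  edgeLabel-injective e e' eq = noMulti G e e' (Sum.map both-ends both-ends
    (sidon _ _ _ _ (toℕ-distinct e) (toℕ-distinct e')
      (start-unique eq (proj₂ (startingAt⇒AP (edge-AP e))) (proj₂ (startingAt⇒AP (edge-AP e'))))))
    where
    toℕ-distinct : ∀ e → toℕ (src e) ≢ toℕ (tgt e)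
    toℕ-distinct e eq = noLoop G e (toℕ-injective eq)
    both-ends : ∀ {x y x' y' : Fin (n G)} → toℕ x ≡ toℕ x' × toℕ y ≡ toℕ y' → x ≡ x' × y ≡ y'
    both-ends = Product.map toℕ-injective toℕ-injective

  label-AIASI : IsAIASI G label
  label-AIASI = (label-injective , edgeLabel-injective) ,
                (λ x → δ (col x) , vertex-detIndex x) ,
                (λ e → startingAt⇒AP (edge-AP e))

  bichromatic⇒prime-ratio : ∀ e → col (src e) ≢ col (tgt e) → HasPrimeRatio G label e
  bichromatic⇒prime-ratio e ≢col = δ (col (src e)) , δ (col (tgt e)) , 2 ,
    vertex-detIndex (src e) , vertex-detIndex (tgt e) , prime[2] , ratio-2 (col (src e)) (col (tgt e)) ≢col
    where
    ratio-2 : ∀ c c' → c ≢ c' → (δ c' ≡ 2 * δ c) ⊎ (δ c ≡ 2 * δ c')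
    ratio-2 false false c≢c' = ⊥-elim (c≢c' refl)
    ratio-2 true  true  c≢c' = ⊥-elim (c≢c' refl)
    ratio-2 false true  _    = inj₁ refl
    ratio-2 true  false _    = inj₂ refl

  prime-ratio⇒bichromatic : ∀ e → HasPrimeRatio G label e → col (src e) ≢ col (tgt e)
  prime-ratio⇒bichromatic e (du , dv , p , hu , hv , p-prime , ratio) same
    with detIndex-unique hu (vertex-detIndex (src e)) | detIndex-unique hv (vertex-detIndex (tgt e))
  ... | refl | refl with ratio
  ... | inj₁ dv≡p*du = ≢-prime-multiple p-prime (1≤δ _) (trans (cong δ same) dv≡p*du)
  ... | inj₂ du≡p*dv = ≢-prime-multiple p-prime (1≤δ _) (trans (cong δ (sym same)) du≡p*dv)

  bichromatic : Subset (m G)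
  bichromatic = tabulate (λ e → col (src e) xor col (tgt e))

  ∈-bichromatic⁻ : ∀ e → e ∈ₛ bichromatic → col (src e) ≢ col (tgt e)
  ∈-bichromatic⁻ e e∈ = xor≡true⇒≢ (col (src e)) (col (tgt e))
    (trans (sym (lookup∘tabulate (λ e → col (src e) xor col (tgt e)) e)) ([]=⇒lookup e∈))
    where
    xor≡true⇒≢ : ∀ c c' → c xor c' ≡ true → c ≢ c'
    xor≡true⇒≢ false false () _
    xor≡true⇒≢ true  true  () _
    xor≡true⇒≢ false true  _  ()
    xor≡true⇒≢ true  false _  ()

  ∈-bichromatic⁺ : ∀ e → col (src e) ≢ col (tgt e) → e ∈ₛ bichromatic
  ∈-bichromatic⁺ e ≢col = lookup⇒[]= e bichromatic
    (trans (lookup∘tabulate (λ e → col (src e) xor col (tgt e)) e) (≢⇒xor≡true (col (src e)) (col (tgt e)) ≢col))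
    where
    ≢⇒xor≡true : ∀ c c' → c ≢ c' → c xor c' ≡ true
    ≢⇒xor≡true false false c≢c' = ⊥-elim (c≢c' refl)
    ≢⇒xor≡true true  true  c≢c' = ⊥-elim (c≢c' refl)
    ≢⇒xor≡true false true  _    = refl
    ≢⇒xor≡true true  false _    = refl

  non-prime-edges : NonPrimeEdgeCount G label ∣ ∁ bichromatic ∣
  non-prime-edges = ∁ bichromatic , refl , λ e →
    (λ e∈∁ prime → x∈∁p⇒x∉p e∈∁ (∈-bichromatic⁺ e (prime-ratio⇒bichromatic e prime))) ,
    (λ ¬prime → x∉p⇒x∈∁p (λ e∈ → ¬prime (bichromatic⇒prime-ratio e (∈-bichromatic⁻ e e∈))))

-- For a colouring realising b(G) exactly b edges are bichromatic, so the
-- induced labelling has m − b non-prime edges.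
dispensing-upper-bound : ∀ G b → IsMaxBipartiteSize G b →
  Σ (Labelling G) λ f → IsAIASI G f × NonPrimeEdgeCount G f (m G ∸ b)
dispensing-upper-bound G b ((s , (col , s-bichromatic) , ∣s∣≡b) , maximal) =
  label , label-AIASI , subst (NonPrimeEdgeCount G label) ∣∁bichromatic∣≡m∸b non-prime-edges
  where
  open ColourLabelling G col
  ∣bichromatic∣≡b : ∣ bichromatic ∣ ≡ b
  ∣bichromatic∣≡b = ≤-antisym (maximal bichromatic (col , ∈-bichromatic⁻))
    (subst (_≤ ∣ bichromatic ∣) ∣s∣≡b (p⊆q⇒∣p∣≤∣q∣ (λ {e} e∈s → ∈-bichromatic⁺ e (s-bichromatic e e∈s))))
  ∣∁bichromatic∣≡m∸b : ∣ ∁ bichromatic ∣ ≡ m G ∸ b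
  ∣∁bichromatic∣≡m∸b = trans (∣∁p∣≡n∸∣p∣ bichromatic) (cong (m G ∸_) ∣bichromatic∣≡b)

-- Theorem 3.2: ϑ(G) = |E(G)| − b(G).
theorem3p2 : (G : Graph) → NoIsolatedVertices G →
    (b : ℕ) → IsMaxBipartiteSize G b →
    IsDispensingNumber G (m G ∸ b)
theorem3p2 G _ b maxBipartite =
  dispensing-upper-bound G b maxBipartite , dispensing-lower-bound G b maxBipartite
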